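{- For every fixed integer $k\ge 1$ there is a constant $N(k)$ such that every $k$-vertex-critical $(P_5,W_4)$-free graph $G$ that contains an induced $\overline{C_7}$ has at most $N(k)$ vertices.
   Context: All graphs are finite, simple and undirected. $P_5$ is the path on $5$ vertices, $\overline{C_7}$ is the complement of the cycle on $7$ vertices, and $W_4$ is the graph consisting of a cycle $C_4$ plus one additional vertex adjacent to all four vertices of the $C_4$. A graph is $(P_5,W_4)$-free if it has no induced subgraph isomorphic to $P_5$ or $W_4$. A graph $G$ is $k$-vertex-critical if $\chi(G)=k$ and $\chi(G-v)<k$ for every $v\in V(G)$. -}

module Defs where

open import Data.Nat using (ℕ; zero; suc; _∸_; _+_; _≡ᵇ_; _<_)
open import Data.Bool using (Bool; true; false; not; _∧_; _∨_)
open import Data.Fin using (Fin; toℕ; punchIn)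
open import Data.Product using (Σ; _×_; ∃)
open import Relation.Binary.PropositionalEquality using (_≡_)
open import Relation.Nullary using (¬_)
open import Function.Definitions using (Injective)

record Graph : Set where
  field
    size  : ℕ
    adj   : Fin size → Fin size → Bool
    sym   : ∀ i j → adj i j ≡ adj j i
    irrefl : ∀ i → adj i i ≡ false
open Graph public

delete : (G : Graph) → Fin (size G) → Graph
delete record { size = suc n ; adj = a ; sym = s ; irrefl = ir } v =
  record { size = n
         ; adj = λ i j → a (punchIn v i) (punchIn v j)
         ; sym = λ i j → s (punchIn v i) (punchIn v j)
         ; irrefl = λ i → ir (punchIn v i) }

Colourable : Graph → ℕ → Set
Colourable G m = Σ (Fin (size G) → Fin m) λ c →
  ∀ i j → adj G i j ≡ true → ¬ (c i ≡ c j)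

ChromaticNumber : Graph → ℕ → Set
ChromaticNumber G k = Colourable G k × (∀ m → m < k → ¬ Colourable G m)

VertexCritical : ℕ → Graph → Set
VertexCritical k G = ChromaticNumber G k ×
  (∀ v → ∃ λ m → m < k × ChromaticNumber (delete G v) m)

ContainsInduced : (m : ℕ) → (Fin m → Fin m → Bool) → Graph → Set
ContainsInduced m H G = Σ (Fin m → Fin (size G)) λ f →
  Injective _≡_ _≡_ f × (∀ i j → adj G (f i) (f j) ≡ H i j)

dist : ℕ → ℕ → ℕ
dist a b = (a ∸ b) + (b ∸ a)

P5 : Fin 5 → Fin 5 → Bool
P5 i j = dist (toℕ i) (toℕ j) ≡ᵇ 1

-- complement of the 7-cycle 0-1-...-6-0
C7bar : Fin 7 → Fin 7 → Bool
C7bar i j = not (d ≡ᵇ 0) ∧ not ((d ≡ᵇ 1) ∨ (d ≡ᵇ 6))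
  where d = dist (toℕ i) (toℕ j)

-- W4 : cycle 0-1-2-3-0 plus hub 4 adjacent to 0,1,2,3
W4 : Fin 5 → Fin 5 → Bool
W4 i j with toℕ i ≡ᵇ 4 | toℕ j ≡ᵇ 4
... | true  | true  = false
... | true  | false = true
... | false | true  = true
... | false | false = (dist (toℕ i) (toℕ j) ≡ᵇ 1) ∨ (dist (toℕ i) (toℕ j) ≡ᵇ 3)

{-# OPTIONS --safe #-}
module Submission where

-- Fix an induced C̄₇ in G and call the set of its vertices adjacent to an outside
-- vertex v the attachment of v.  Inspecting the C̄₇ together with one, two or three
-- outside vertices for induced copies of P₅ and W₄ shows that only 29 attachments
-- occur, that vertices with empty attachment have neighbours only among themselves,
-- and that for every other attachment a either two nonadjacent vertices with
-- attachment a already create a P₅ or W₄, or these vertices induce a P₃-free graph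
-- to which every other attachment class is complete or anticomplete.  A critical
-- graph is connected, so the empty attachment does not occur.  In the P₃-free case
-- two nonadjacent vertices x and y of attachment a are impossible: every colour of
-- a (k - 1)-colouring of G - x occurs in N(x), and choosing such neighbours maps the
-- clique of y within its class injectively into the clique of x minus x, and
-- symmetrically.  So every attachment class is a clique, a colour class meets each
-- of them and each vertex of the C̄₇ at most once, and G has at most (7 + 29) k
-- vertices.

open import Defs
open import Data.Nat using (ℕ; _≤_)
open import Data.Product using (∃)
open import Relation.Nullary using (¬_)

open import Agda.Builtin.FromNat using (Number; fromNat)
open import Data.Bool using (Bool; true; false)
import Data.Bool.Properties as Bool
open import Data.Empty using (⊥; ⊥-elim)
open import Data.Fin using (Fin; zero; suc; splitAt; join; punchOut; inject≤; combine)
open import Data.Fin.Properties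
  using (_≟_; all?; any?; splitAt-join; join-splitAt; inject≤-injective; punchIn-punchOut;
         punchOut-injective; injective⇒≤; combine-injective)
import Data.Fin.Literals as Fin
open import Data.Fin.Subset using (Subset; ⁅_⁆; ⋃)
open import Data.Fin.Subset.Properties using (anySubset?)
open import Data.List using (List; []; _∷_; map)
open import Data.List.Relation.Unary.Any as Any using (Any; satisfied)
open import Data.Nat using (zero; suc; _+_; _*_; _<_; pred)
import Data.Nat.Literals as ℕ
open import Data.Nat.Properties using (<⇒≤pred; 1+n≰n; n<1+n)
open import Data.Product using (Σ; _×_; _,_; proj₁; proj₂)
open import Data.Sum using (_⊎_; inj₁; inj₂; [_,_])
open import Data.Sum.Properties using (inj₁-injective; inj₂-injective)
open import Data.Unit using (⊤; tt)
open import Data.Vec as Vec using (Vec; []; _∷_; lookup; tabulate)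
open import Data.Vec.Properties using (≡-dec; lookup∘tabulate; lookup-map; lookup-replicate)
open import Data.Vec.Relation.Unary.All using ([]; _∷_)
open import Data.Vec.Relation.Unary.AllPairs using ([]; _∷_)
open import Data.Vec.Relation.Unary.Unique.Propositional using (Unique)
open import Data.Vec.Relation.Unary.Unique.Propositional.Properties using (lookup-injective)
open import Function using (_∘_; case_of_)
open import Function.Definitions using (Injective)
open import Relation.Binary.Definitions using (DecidableEquality)
open import Relation.Binary.PropositionalEquality
  using (_≡_; _≢_; refl; trans; cong; cong₂; subst; subst₂; module ≡-Reasoning)
import Relation.Binary.PropositionalEquality as ≡
open import Relation.Nullary using (Dec; yes; no; ¬?)
open import Relation.Nullary.Decidable
  using (from-yes; decidable-stable; map′; _×-dec_; _⊎-dec_; _→-dec_)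

instance
  ℕ-literals : Number ℕ
  ℕ-literals = ℕ.number

  Fin-literals : ∀ {n} → Number (Fin n)
  Fin-literals = Fin.number _

  ⊤-instance : ⊤
  ⊤-instance = tt

-- Colourings

Vertex : Graph → Set
Vertex G = Fin (size G)

Proper : (G : Graph) {m : ℕ} → (Vertex G → Fin m) → Set
Proper G c = ∀ i j → adj G i j ≡ true → c i ≢ c j

ProperExcept : (G : Graph) {m : ℕ} → Vertex G → (Vertex G → Fin m) → Set
ProperExcept G x c = ∀ i j → i ≢ x → j ≢ x → adj G i j ≡ true → c i ≢ c j

adj⇒≢ : (G : Graph) {u v : Vertex G} → adj G u v ≡ true → u ≢ v
adj⇒≢ G {u} uv refl = case trans (≡.sym uv) (irrefl G u) of λ ()

-- The vertex y only provides a colour for x, where the colouring is unconstrained.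
delete-colouring : (G : Graph) {m : ℕ} {x y : Vertex G} → y ≢ x →
                   Colourable (delete G x) m → Σ (Vertex G → Fin m) (ProperExcept G x)
delete-colouring record { size = suc n ; adj = a } {m} {x} {y} y≢x (c , proper) =
  colour , colour-proper
  where
  colour : Fin (suc n) → Fin m
  colour i with x ≟ i
  ... | yes _   = c (punchOut (y≢x ∘ ≡.sym))
  ... | no  x≢i = c (punchOut x≢i)

  colour-proper : ∀ i j → i ≢ x → j ≢ x → a i j ≡ true → colour i ≢ colour j
  colour-proper i j i≢x j≢x ij with x ≟ i | x ≟ j
  ... | yes x≡i | _       = ⊥-elim (i≢x (≡.sym x≡i))
  ... | no  _   | yes x≡j = ⊥-elim (j≢x (≡.sym x≡j))
  ... | no  x≢i | no  x≢j = proper (punchOut x≢i) (punchOut x≢j)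
    (subst₂ (λ u v → a u v ≡ true) (≡.sym (punchIn-punchOut x≢i)) (≡.sym (punchIn-punchOut x≢j)) ij)

colour-at-neighbour : (G : Graph) {m : ℕ} {x : Vertex G} → ¬ Colourable G m →
                      (c : Vertex G → Fin m) → ProperExcept G x c →
                      ∀ col → ∃ λ w → adj G x w ≡ true × c w ≡ col
colour-at-neighbour G {m} {x} not-colourable c proper col
  with any? (λ w → (adj G x w Bool.≟ true) ×-dec (c w ≟ col))
... | yes found   = found
... | no  missing = ⊥-elim (not-colourable (recoloured , recoloured-proper))
  where
  recoloured : Vertex G → Fin m
  recoloured i with x ≟ i
  ... | yes _ = col
  ... | no  _ = c i

  recoloured-proper : Proper G recoloured
  recoloured-proper i j ij with x ≟ i | x ≟ j
  ... | yes refl | yes refl = ⊥-elim (adj⇒≢ G ij refl)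
  ... | yes refl | no  _    = λ col≡cj → missing (j , ij , ≡.sym col≡cj)
  ... | no  _    | yes refl = λ ci≡col → missing (i , trans (sym G x i) ij , ci≡col)
  ... | no  x≢i  | no  x≢j  = proper i j (x≢i ∘ ≡.sym) (x≢j ∘ ≡.sym) ij

critical-not-colourable : ∀ {k G} → VertexCritical k G → Vertex G → ¬ Colourable G (pred k)
critical-not-colourable {zero}  ((c , _) , _)     v = case proj₁ c v of λ ()
critical-not-colourable {suc k} ((_ , fewer) , _) _ = fewer k (n<1+n k)

critical-colouring-except : ∀ {k G} → VertexCritical k G → {x y : Vertex G} → y ≢ x →
                            Σ (Vertex G → Fin (pred k)) (ProperExcept G x)
critical-colouring-except {G = G} (_ , critical) {x} y≢x with critical x
... | m , m<k , colourable , _ with delete-colouring G y≢x colourable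
... | c , proper =
  (λ v → inject≤ (c v) (<⇒≤pred m<k)) ,
  λ i j i≢x j≢x ij → proper i j i≢x j≢x ij ∘ inject≤-injective _ _ (c i) (c j)

critical⇒connected : ∀ {k G} → VertexCritical k G → {S : Vertex G → Set} → (∀ v → Dec (S v)) →
                     (∀ v w → S v → ¬ S w → adj G v w ≡ false) → ∀ {u w} → S u → ¬ S w → ⊥
critical⇒connected {k} {G} critical {S} S? separated {u} {w} u∈S w∉S =
  critical-not-colourable critical u (glued , glued-proper)
  where
  u≢w : u ≢ w
  u≢w refl = w∉S u∈S

  on-S : Σ (Vertex G → Fin (pred k)) (ProperExcept G w)
  on-S = critical-colouring-except critical u≢w

  off-S : Σ (Vertex G → Fin (pred k)) (ProperExcept G u)
  off-S = critical-colouring-except critical (u≢w ∘ ≡.sym)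

  glued : Vertex G → Fin (pred k)
  glued v with S? v
  ... | yes _ = proj₁ on-S v
  ... | no  _ = proj₁ off-S v

  glued-proper : Proper G glued
  glued-proper i j ij with S? i | S? j
  ... | yes i∈S | yes j∈S =
    proj₂ on-S i j (λ where refl → w∉S i∈S) (λ where refl → w∉S j∈S) ij
  ... | yes i∈S | no  j∉S = λ _ → case trans (≡.sym ij) (separated i j i∈S j∉S) of λ ()
  ... | no  i∉S | yes j∈S =
    λ _ → case trans (≡.sym ij) (trans (sym G i j) (separated j i j∈S i∉S)) of λ ()
  ... | no  i∉S | no  j∉S =
    proj₂ off-S i j (λ where refl → i∉S u∈S) (λ where refl → j∉S u∈S) ij

size≤labels*colours : (G : Graph) {r k : ℕ} (c : Vertex G → Fin k) → Proper G c →
                      (ℓ : Vertex G → Fin r) →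
                      (∀ {v w} → v ≢ w → ℓ v ≡ ℓ w → adj G v w ≡ true) → size G ≤ r * k
size≤labels*colours G c proper ℓ same-label⇒adj = injective⇒≤ code-injective
  where
  code-injective : Injective _≡_ _≡_ (λ v → combine (ℓ v) (c v))
  code-injective {v} {w} eq with combine-injective (ℓ v) (c v) (ℓ w) (c w) eq
  ... | ℓv≡ℓw , cv≡cw =
    decidable-stable (v ≟ w) λ v≢w → proper v w (same-label⇒adj v≢w ℓv≡ℓw) cv≡cw

no-injection-into-proper-subset :
  ∀ {n} {P : Fin n → Set} → (∀ v → Dec (P v)) → (ψ : Fin n → Fin n) →
  (∀ {v} → P v → P (ψ v)) → (∀ {v w} → P v → P w → ψ v ≡ ψ w → v ≡ w) →
  ∀ {x} → P x → ¬ (∀ {v} → P v → ψ v ≢ x)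
no-injection-into-proper-subset {suc n} {P} P? ψ into injective {x} Px misses =
  1+n≰n (injective⇒≤ shrunk-injective)
  where
  ψ′ : Fin (suc n) → Fin (suc n)
  ψ′ v with P? v
  ... | yes _ = ψ v
  ... | no  _ = v

  ψ′-misses : ∀ v → ψ′ v ≢ x
  ψ′-misses v with P? v
  ... | yes Pv  = misses Pv
  ... | no  ¬Pv = λ where refl → ¬Pv Px

  ψ′-injective : Injective _≡_ _≡_ ψ′
  ψ′-injective {v} {w} eq with P? v | P? w
  ... | yes Pv  | yes Pw  = injective Pv Pw eq
  ... | yes Pv  | no  ¬Pw = ⊥-elim (¬Pw (subst P eq (into Pv)))
  ... | no  ¬Pv | yes Pw  = ⊥-elim (¬Pv (subst P (≡.sym eq) (into Pw)))
  ... | no  _   | no  _   = eq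

  shrunk : Fin (suc n) → Fin n
  shrunk v = punchOut (ψ′-misses v ∘ ≡.sym)

  shrunk-injective : Injective _≡_ _≡_ shrunk
  shrunk-injective {v} {w} =
    ψ′-injective ∘ punchOut-injective {i = x} (ψ′-misses v ∘ ≡.sym) (ψ′-misses w ∘ ≡.sym)

allSubsets? : ∀ {n} {P : Subset n → Set} → (∀ s → Dec (P s)) → Dec (∀ s → P s)
allSubsets? P? =
  map′ (λ ¬∃¬P s → decidable-stable (P? s) (λ ¬Ps → ¬∃¬P (s , ¬Ps)))
       (λ ∀P (s , ¬Ps) → ¬Ps (∀P s))
       (¬? (anySubset? (¬? ∘ P?)))

Adjacency : ℕ → Set
Adjacency n = Fin n → Fin n → Bool

-- Adjacency comes first so that deciding it rejects most candidates cheaply.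
InducedCopy : ∀ {m n} → Adjacency m → Adjacency n → (Fin m → Fin n) → Set
InducedCopy H M p = (∀ i j → M (p i) (p j) ≡ H i j) × Injective _≡_ _≡_ p

injective? : ∀ {m n} (p : Fin m → Fin n) → Dec (Injective _≡_ _≡_ p)
injective? p = map′ (λ inj {i} {j} → inj i j) (λ inj i j → inj {i} {j})
  (all? λ i → all? λ j → (p i ≟ p j) →-dec (i ≟ j))

inducedCopy? : ∀ {m n} (H : Adjacency m) (M : Adjacency n) p → Dec (InducedCopy H M p)
inducedCopy? H M p = (all? λ i → all? λ j → M (p i) (p j) Bool.≟ H i j) ×-dec injective? p

induced-trans : ∀ {m n} {H : Adjacency m} {M : Adjacency n} (G : Graph) {g : Fin n → Vertex G} →
                InducedCopy M (adj G) g → ∀ {p} → InducedCopy H M p → ContainsInduced m H G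
induced-trans G {g} (g-adj , g-injective) {p} (p-adj , p-injective) =
  g ∘ p , p-injective ∘ g-injective , λ i j → trans (g-adj (p i) (p j)) (p-adj i j)

data Shape : Set where
  path wheel : Shape

shapeAdj : Shape → Adjacency 5
shapeAdj path  = P5
shapeAdj wheel = W4

record Copy (n : ℕ) : Set where
  constructor _at_
  field
    shape    : Shape
    vertices : Vec (Fin n) 5

IsCopy : ∀ {n} → Adjacency n → Copy n → Set
IsCopy M (s at vs) = InducedCopy (shapeAdj s) M (lookup vs)

HasCopyAmong : ∀ {n} → List (Copy n) → Adjacency n → Set
HasCopyAmong cs M = Any (IsCopy M) cs

isCopy? : ∀ {n} (M : Adjacency n) c → Dec (IsCopy M c)
isCopy? M (s at vs) = inducedCopy? (shapeAdj s) M (lookup vs)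

hasCopyAmong? : ∀ {n} cs (M : Adjacency n) → Dec (HasCopyAmong cs M)
hasCopyAmong? cs M = Any.any? (isCopy? M) cs

-- Configurations around C̄₇

-- Vertices 0, …, 6 of extension ns E induce C̄₇, vertex 7 + p is adjacent to the
-- vertices in lookup ns p among them, and E is the adjacency among vertices 7, 8, ….
extend : ∀ {r} → Vec (Subset 7) r → Adjacency r → Fin 7 ⊎ Fin r → Fin 7 ⊎ Fin r → Bool
extend ns E (inj₁ i) (inj₁ j) = C7bar i j
extend ns E (inj₁ i) (inj₂ q) = lookup (lookup ns q) i
extend ns E (inj₂ p) (inj₁ j) = lookup (lookup ns p) j
extend ns E (inj₂ p) (inj₂ q) = E p q

extension : ∀ {r} → Vec (Subset 7) r → Adjacency r → Adjacency (7 + r)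
extension ns E u v = extend ns E (splitAt 7 u) (splitAt 7 v)

edge : Bool → Adjacency 2
edge e zero (suc zero) = e
edge e (suc zero) zero = e
edge _ _ _ = false

path₃ : Adjacency 3
path₃ zero (suc zero) = true
path₃ (suc zero) zero = true
path₃ (suc zero) (suc (suc zero)) = true
path₃ (suc (suc zero)) (suc zero) = true
path₃ _ _ = false

⟦_⟧ : List (Fin 7) → Subset 7
⟦ is ⟧ = ⋃ (map ⁅_⁆ is)

_≟ˢ_ : DecidableEquality (Subset 7)
_≟ˢ_ = ≡-dec Bool._≟_

Attachment : Set
Attachment = Fin 29

attachments : Vec (Subset 7) 29
attachments =
  ⟦ [] ⟧ ∷
  ⟦ 5 ∷ 6 ∷ [] ⟧ ∷
  ⟦ 4 ∷ 5 ∷ [] ⟧ ∷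
  ⟦ 4 ∷ 5 ∷ 6 ∷ [] ⟧ ∷
  ⟦ 3 ∷ 4 ∷ [] ⟧ ∷
  ⟦ 3 ∷ 4 ∷ 5 ∷ [] ⟧ ∷
  ⟦ 2 ∷ 3 ∷ [] ⟧ ∷
  ⟦ 2 ∷ 3 ∷ 4 ∷ [] ⟧ ∷
  ⟦ 1 ∷ 3 ∷ 5 ∷ 6 ∷ [] ⟧ ∷
  ⟦ 1 ∷ 3 ∷ 4 ∷ 6 ∷ [] ⟧ ∷
  ⟦ 1 ∷ 3 ∷ 4 ∷ 5 ∷ 6 ∷ [] ⟧ ∷
  ⟦ 1 ∷ 2 ∷ [] ⟧ ∷
  ⟦ 1 ∷ 2 ∷ 4 ∷ 6 ∷ [] ⟧ ∷
  ⟦ 1 ∷ 2 ∷ 3 ∷ [] ⟧ ∷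
  ⟦ 1 ∷ 2 ∷ 3 ∷ 4 ∷ 6 ∷ [] ⟧ ∷
  ⟦ 0 ∷ 6 ∷ [] ⟧ ∷
  ⟦ 0 ∷ 5 ∷ 6 ∷ [] ⟧ ∷
  ⟦ 0 ∷ 2 ∷ 4 ∷ 6 ∷ [] ⟧ ∷
  ⟦ 0 ∷ 2 ∷ 4 ∷ 5 ∷ [] ⟧ ∷
  ⟦ 0 ∷ 2 ∷ 4 ∷ 5 ∷ 6 ∷ [] ⟧ ∷
  ⟦ 0 ∷ 2 ∷ 3 ∷ 5 ∷ [] ⟧ ∷
  ⟦ 0 ∷ 2 ∷ 3 ∷ 4 ∷ 5 ∷ [] ⟧ ∷
  ⟦ 0 ∷ 1 ∷ [] ⟧ ∷
  ⟦ 0 ∷ 1 ∷ 6 ∷ [] ⟧ ∷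
  ⟦ 0 ∷ 1 ∷ 3 ∷ 5 ∷ [] ⟧ ∷
  ⟦ 0 ∷ 1 ∷ 3 ∷ 5 ∷ 6 ∷ [] ⟧ ∷
  ⟦ 0 ∷ 1 ∷ 2 ∷ [] ⟧ ∷
  ⟦ 0 ∷ 1 ∷ 2 ∷ 4 ∷ 6 ∷ [] ⟧ ∷
  ⟦ 0 ∷ 1 ∷ 2 ∷ 3 ∷ 5 ∷ [] ⟧ ∷
  []

-- Positions of induced copies of P₅ and W₄ in configurations, found by a computer
-- search; only copies verified below are used.
oneVertexCopies : List (Copy 8)
oneVertexCopies =
  wheel at (7 ∷ 6 ∷ 4 ∷ 0 ∷ 2 ∷ []) ∷
  wheel at (7 ∷ 6 ∷ 2 ∷ 0 ∷ 4 ∷ []) ∷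
  wheel at (7 ∷ 5 ∷ 0 ∷ 4 ∷ 2 ∷ []) ∷
  path at (7 ∷ 6 ∷ 4 ∷ 0 ∷ 5 ∷ []) ∷
  path at (7 ∷ 5 ∷ 3 ∷ 6 ∷ 4 ∷ []) ∷
  path at (7 ∷ 4 ∷ 6 ∷ 3 ∷ 5 ∷ []) ∷
  wheel at (7 ∷ 4 ∷ 6 ∷ 3 ∷ 1 ∷ []) ∷
  path at (7 ∷ 3 ∷ 1 ∷ 4 ∷ 2 ∷ []) ∷
  wheel at (7 ∷ 6 ∷ 3 ∷ 5 ∷ 1 ∷ []) ∷
  wheel at (7 ∷ 4 ∷ 1 ∷ 3 ∷ 6 ∷ []) ∷
  path at (7 ∷ 0 ∷ 5 ∷ 1 ∷ 6 ∷ []) ∷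
  wheel at (7 ∷ 3 ∷ 0 ∷ 2 ∷ 5 ∷ []) ∷
  wheel at (7 ∷ 1 ∷ 5 ∷ 0 ∷ 3 ∷ []) ∷
  path at (7 ∷ 1 ∷ 6 ∷ 2 ∷ 0 ∷ []) ∷
  wheel at (7 ∷ 5 ∷ 2 ∷ 4 ∷ 0 ∷ []) ∷
  path at (7 ∷ 2 ∷ 0 ∷ 3 ∷ 1 ∷ []) ∷
  wheel at (5 ∷ 2 ∷ 4 ∷ 1 ∷ 7 ∷ []) ∷
  path at (7 ∷ 4 ∷ 2 ∷ 5 ∷ 3 ∷ []) ∷
  []

twoVertexCopies : List (Copy 9)
twoVertexCopies =
  path at (7 ∷ 8 ∷ 6 ∷ 3 ∷ 5 ∷ []) ∷
  path at (7 ∷ 8 ∷ 6 ∷ 2 ∷ 0 ∷ []) ∷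
  path at (7 ∷ 8 ∷ 5 ∷ 1 ∷ 6 ∷ []) ∷
  path at (7 ∷ 8 ∷ 3 ∷ 6 ∷ 4 ∷ []) ∷
  path at (7 ∷ 8 ∷ 4 ∷ 0 ∷ 5 ∷ []) ∷
  path at (7 ∷ 8 ∷ 1 ∷ 4 ∷ 2 ∷ []) ∷
  path at (7 ∷ 8 ∷ 0 ∷ 3 ∷ 1 ∷ []) ∷
  path at (7 ∷ 8 ∷ 2 ∷ 5 ∷ 3 ∷ []) ∷
  path at (7 ∷ 8 ∷ 5 ∷ 2 ∷ 4 ∷ []) ∷
  path at (7 ∷ 8 ∷ 4 ∷ 1 ∷ 3 ∷ []) ∷
  path at (7 ∷ 8 ∷ 3 ∷ 0 ∷ 2 ∷ []) ∷
  path at (7 ∷ 8 ∷ 2 ∷ 6 ∷ 1 ∷ []) ∷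
  path at (7 ∷ 8 ∷ 1 ∷ 5 ∷ 0 ∷ []) ∷
  path at (7 ∷ 8 ∷ 0 ∷ 4 ∷ 6 ∷ []) ∷
  path at (7 ∷ 8 ∷ 6 ∷ 4 ∷ 0 ∷ []) ∷
  path at (7 ∷ 8 ∷ 6 ∷ 1 ∷ 5 ∷ []) ∷
  path at (7 ∷ 8 ∷ 5 ∷ 3 ∷ 6 ∷ []) ∷
  path at (7 ∷ 8 ∷ 4 ∷ 2 ∷ 5 ∷ []) ∷
  path at (7 ∷ 8 ∷ 3 ∷ 1 ∷ 4 ∷ []) ∷
  path at (7 ∷ 8 ∷ 2 ∷ 0 ∷ 3 ∷ []) ∷
  path at (7 ∷ 8 ∷ 1 ∷ 6 ∷ 2 ∷ []) ∷
  path at (7 ∷ 6 ∷ 4 ∷ 8 ∷ 5 ∷ []) ∷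
  path at (7 ∷ 6 ∷ 1 ∷ 8 ∷ 0 ∷ []) ∷
  path at (7 ∷ 5 ∷ 3 ∷ 8 ∷ 4 ∷ []) ∷
  path at (7 ∷ 5 ∷ 0 ∷ 8 ∷ 6 ∷ []) ∷
  path at (7 ∷ 4 ∷ 6 ∷ 8 ∷ 5 ∷ []) ∷
  path at (7 ∷ 3 ∷ 5 ∷ 8 ∷ 4 ∷ []) ∷
  path at (7 ∷ 2 ∷ 4 ∷ 8 ∷ 3 ∷ []) ∷
  path at (7 ∷ 4 ∷ 2 ∷ 8 ∷ 3 ∷ []) ∷
  path at (7 ∷ 3 ∷ 1 ∷ 8 ∷ 2 ∷ []) ∷
  path at (7 ∷ 2 ∷ 0 ∷ 8 ∷ 1 ∷ []) ∷
  path at (7 ∷ 1 ∷ 6 ∷ 8 ∷ 0 ∷ []) ∷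
  path at (7 ∷ 1 ∷ 3 ∷ 8 ∷ 2 ∷ []) ∷
  path at (7 ∷ 0 ∷ 5 ∷ 8 ∷ 6 ∷ []) ∷
  path at (7 ∷ 0 ∷ 2 ∷ 8 ∷ 1 ∷ []) ∷
  wheel at (8 ∷ 6 ∷ 7 ∷ 5 ∷ 3 ∷ []) ∷
  wheel at (8 ∷ 6 ∷ 7 ∷ 0 ∷ 4 ∷ []) ∷
  wheel at (8 ∷ 3 ∷ 7 ∷ 2 ∷ 5 ∷ []) ∷
  path at (8 ∷ 7 ∷ 6 ∷ 3 ∷ 5 ∷ []) ∷
  path at (8 ∷ 7 ∷ 6 ∷ 3 ∷ 0 ∷ []) ∷
  path at (8 ∷ 7 ∷ 5 ∷ 2 ∷ 6 ∷ []) ∷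
  path at (8 ∷ 7 ∷ 4 ∷ 1 ∷ 5 ∷ []) ∷
  path at (8 ∷ 7 ∷ 3 ∷ 6 ∷ 4 ∷ []) ∷
  path at (8 ∷ 7 ∷ 2 ∷ 6 ∷ 3 ∷ []) ∷
  wheel at (8 ∷ 7 ∷ 6 ∷ 3 ∷ 1 ∷ []) ∷
  wheel at (8 ∷ 7 ∷ 6 ∷ 2 ∷ 4 ∷ []) ∷
  wheel at (8 ∷ 7 ∷ 5 ∷ 2 ∷ 0 ∷ []) ∷
  wheel at (8 ∷ 7 ∷ 5 ∷ 1 ∷ 3 ∷ []) ∷
  wheel at (8 ∷ 7 ∷ 4 ∷ 1 ∷ 6 ∷ []) ∷
  wheel at (8 ∷ 7 ∷ 4 ∷ 0 ∷ 2 ∷ []) ∷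
  wheel at (8 ∷ 7 ∷ 3 ∷ 6 ∷ 1 ∷ []) ∷
  wheel at (8 ∷ 7 ∷ 3 ∷ 0 ∷ 5 ∷ []) ∷
  wheel at (8 ∷ 7 ∷ 2 ∷ 6 ∷ 4 ∷ []) ∷
  wheel at (8 ∷ 7 ∷ 2 ∷ 5 ∷ 0 ∷ []) ∷
  wheel at (8 ∷ 7 ∷ 1 ∷ 5 ∷ 3 ∷ []) ∷
  wheel at (8 ∷ 7 ∷ 1 ∷ 4 ∷ 6 ∷ []) ∷
  wheel at (8 ∷ 7 ∷ 0 ∷ 4 ∷ 2 ∷ []) ∷
  wheel at (8 ∷ 7 ∷ 0 ∷ 3 ∷ 5 ∷ []) ∷
  wheel at (8 ∷ 4 ∷ 7 ∷ 3 ∷ 6 ∷ []) ∷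
  path at (8 ∷ 7 ∷ 5 ∷ 2 ∷ 4 ∷ []) ∷
  path at (8 ∷ 7 ∷ 1 ∷ 6 ∷ 2 ∷ []) ∷
  wheel at (8 ∷ 5 ∷ 7 ∷ 4 ∷ 2 ∷ []) ∷
  wheel at (8 ∷ 2 ∷ 7 ∷ 1 ∷ 6 ∷ []) ∷
  wheel at (8 ∷ 1 ∷ 7 ∷ 0 ∷ 5 ∷ []) ∷
  path at (8 ∷ 7 ∷ 6 ∷ 4 ∷ 0 ∷ []) ∷
  path at (8 ∷ 7 ∷ 6 ∷ 1 ∷ 5 ∷ []) ∷
  path at (8 ∷ 7 ∷ 5 ∷ 3 ∷ 6 ∷ []) ∷
  path at (8 ∷ 7 ∷ 4 ∷ 2 ∷ 5 ∷ []) ∷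
  path at (8 ∷ 7 ∷ 4 ∷ 1 ∷ 3 ∷ []) ∷
  path at (8 ∷ 7 ∷ 3 ∷ 6 ∷ 2 ∷ []) ∷
  path at (8 ∷ 7 ∷ 3 ∷ 1 ∷ 4 ∷ []) ∷
  path at (8 ∷ 7 ∷ 2 ∷ 6 ∷ 1 ∷ []) ∷
  path at (8 ∷ 7 ∷ 2 ∷ 0 ∷ 3 ∷ []) ∷
  path at (8 ∷ 7 ∷ 1 ∷ 5 ∷ 2 ∷ []) ∷
  path at (8 ∷ 7 ∷ 1 ∷ 5 ∷ 0 ∷ []) ∷
  path at (8 ∷ 7 ∷ 0 ∷ 4 ∷ 6 ∷ []) ∷
  path at (8 ∷ 7 ∷ 0 ∷ 4 ∷ 1 ∷ []) ∷
  path at (8 ∷ 6 ∷ 7 ∷ 5 ∷ 0 ∷ []) ∷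
  path at (8 ∷ 6 ∷ 7 ∷ 0 ∷ 5 ∷ []) ∷
  path at (8 ∷ 5 ∷ 7 ∷ 6 ∷ 4 ∷ []) ∷
  path at (8 ∷ 5 ∷ 7 ∷ 4 ∷ 6 ∷ []) ∷
  path at (8 ∷ 4 ∷ 7 ∷ 5 ∷ 3 ∷ []) ∷
  path at (8 ∷ 4 ∷ 7 ∷ 3 ∷ 5 ∷ []) ∷
  path at (8 ∷ 3 ∷ 7 ∷ 4 ∷ 2 ∷ []) ∷
  path at (8 ∷ 3 ∷ 7 ∷ 2 ∷ 4 ∷ []) ∷
  path at (8 ∷ 2 ∷ 7 ∷ 3 ∷ 1 ∷ []) ∷
  path at (8 ∷ 2 ∷ 7 ∷ 1 ∷ 3 ∷ []) ∷
  path at (8 ∷ 1 ∷ 7 ∷ 2 ∷ 0 ∷ []) ∷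
  path at (8 ∷ 1 ∷ 7 ∷ 0 ∷ 2 ∷ []) ∷
  path at (8 ∷ 0 ∷ 7 ∷ 6 ∷ 1 ∷ []) ∷
  path at (8 ∷ 0 ∷ 7 ∷ 1 ∷ 6 ∷ []) ∷
  path at (6 ∷ 8 ∷ 7 ∷ 5 ∷ 0 ∷ []) ∷
  path at (6 ∷ 8 ∷ 7 ∷ 0 ∷ 5 ∷ []) ∷
  path at (6 ∷ 4 ∷ 7 ∷ 8 ∷ 5 ∷ []) ∷
  path at (6 ∷ 1 ∷ 7 ∷ 8 ∷ 0 ∷ []) ∷
  path at (5 ∷ 8 ∷ 7 ∷ 6 ∷ 4 ∷ []) ∷
  path at (5 ∷ 3 ∷ 7 ∷ 8 ∷ 4 ∷ []) ∷
  path at (4 ∷ 8 ∷ 7 ∷ 5 ∷ 3 ∷ []) ∷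
  path at (4 ∷ 2 ∷ 7 ∷ 8 ∷ 3 ∷ []) ∷
  path at (3 ∷ 8 ∷ 7 ∷ 4 ∷ 2 ∷ []) ∷
  path at (3 ∷ 1 ∷ 7 ∷ 8 ∷ 2 ∷ []) ∷
  path at (2 ∷ 8 ∷ 7 ∷ 3 ∷ 1 ∷ []) ∷
  path at (2 ∷ 0 ∷ 7 ∷ 8 ∷ 1 ∷ []) ∷
  path at (1 ∷ 8 ∷ 7 ∷ 2 ∷ 0 ∷ []) ∷
  path at (1 ∷ 6 ∷ 7 ∷ 8 ∷ 0 ∷ []) ∷
  []

pathCopies : List (Copy 10)
pathCopies =
  wheel at (9 ∷ 6 ∷ 7 ∷ 5 ∷ 8 ∷ []) ∷
  wheel at (9 ∷ 4 ∷ 7 ∷ 3 ∷ 8 ∷ []) ∷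
  wheel at (9 ∷ 2 ∷ 7 ∷ 1 ∷ 8 ∷ []) ∷
  wheel at (9 ∷ 6 ∷ 7 ∷ 0 ∷ 8 ∷ []) ∷
  wheel at (9 ∷ 5 ∷ 7 ∷ 4 ∷ 8 ∷ []) ∷
  wheel at (9 ∷ 3 ∷ 7 ∷ 2 ∷ 8 ∷ []) ∷
  wheel at (9 ∷ 1 ∷ 7 ∷ 0 ∷ 8 ∷ []) ∷
  []

empty : Attachment
empty = zero

oneVertex : Subset 7 → Adjacency 8
oneVertex s = extension (s ∷ []) λ _ _ → false

twoVertices : Attachment → Attachment → Bool → Adjacency 9
twoVertices a b e = extension (lookup attachments a ∷ lookup attachments b ∷ []) (edge e)

threeVerticesPath : Attachment → Adjacency 10
threeVerticesPath a = extension (Vec.replicate 3 (lookup attachments a)) path₃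

ForbiddenVertex : Subset 7 → Set
ForbiddenVertex s = HasCopyAmong oneVertexCopies (oneVertex s)

ForbiddenPair : Attachment → Attachment → Bool → Set
ForbiddenPair a b e = HasCopyAmong twoVertexCopies (twoVertices a b e)

ForbiddenPath : Attachment → Set
ForbiddenPath a = HasCopyAmong pathCopies (threeVerticesPath a)

-- The vertices of attachment a induce a P₃-free graph, and every other attachment
-- class is complete or anticomplete to them.
Clustered : Attachment → Set
Clustered a = ForbiddenPath a × (∀ b → b ≢ a → ForbiddenPair a b true ⊎ ForbiddenPair a b false)

forbiddenPair? : ∀ a b e → Dec (ForbiddenPair a b e)
forbiddenPair? a b e = hasCopyAmong? twoVertexCopies (twoVertices a b e)

clustered? : ∀ a → Dec (Clustered a)
clustered? a = hasCopyAmong? pathCopies (threeVerticesPath a) ×-dec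
  all? λ b → ¬? (b ≟ a) →-dec (forbiddenPair? a b true ⊎-dec forbiddenPair? a b false)

-- Opaque, so that using these facts does not repeat the evaluation that proves them.
opaque
  attachment-listed : ∀ s → (∃ λ a → lookup attachments a ≡ s) ⊎ ForbiddenVertex s
  attachment-listed = from-yes (allSubsets? λ s →
    any? (λ a → lookup attachments a ≟ˢ s) ⊎-dec hasCopyAmong? oneVertexCopies (oneVertex s))

  empty-isolated : ∀ b → b ≢ empty → ForbiddenPair empty b true
  empty-isolated = from-yes (all? λ b → ¬? (b ≟ empty) →-dec forbiddenPair? empty b true)

  complete-or-clustered : ∀ a → a ≢ empty → ForbiddenPair a a false ⊎ Clustered a
  complete-or-clustered = from-yes (all? λ a → ¬? (a ≟ empty) →-dec
    (forbiddenPair? a a false ⊎-dec clustered? a))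

-- The graph around an induced C̄₇

module AroundC7bar (G : Graph) (noP5 : ¬ ContainsInduced 5 P5 G) (noW4 : ¬ ContainsInduced 5 W4 G)
  (f : Fin 7 → Vertex G) (f-injective : Injective _≡_ _≡_ f)
  (f-adj : ∀ i j → adj G (f i) (f j) ≡ C7bar i j) where

  Outside : Vertex G → Set
  Outside v = ∀ i → f i ≢ v

  attachment : Vertex G → Subset 7
  attachment v = tabulate (adj G v ∘ f)

  record InClass (a : Attachment) (v : Vertex G) : Set where
    constructor in-class
    field
      is-outside     : Outside v
      has-attachment : attachment v ≡ lookup attachments a
  open InClass

  inClass? : ∀ a v → Dec (InClass a v)
  inClass? a v = map′ (λ (out , att) → in-class out att) (λ c → is-outside c , has-attachment c)
    ((all? λ i → ¬? (f i ≟ v)) ×-dec (attachment v ≟ˢ lookup attachments a))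

  on-C7bar-or-outside : ∀ v → (∃ λ i → f i ≡ v) ⊎ Outside v
  on-C7bar-or-outside v with any? (λ i → f i ≟ v)
  ... | yes on-C7bar = inj₁ on-C7bar
  ... | no  none     = inj₂ λ i fi≡v → none (i , fi≡v)

  attachment-lookup : ∀ v i → lookup (attachment v) i ≡ adj G v (f i)
  attachment-lookup v i = lookup∘tabulate (adj G v ∘ f) i

  same-attachment : ∀ {v w} → attachment v ≡ attachment w → ∀ i → adj G v (f i) ≡ adj G w (f i)
  same-attachment {v} {w} eq i = begin
    adj G v (f i)             ≡⟨ attachment-lookup v i ⟨
    lookup (attachment v) i   ≡⟨ cong (λ s → lookup s i) eq ⟩
    lookup (attachment w) i   ≡⟨ attachment-lookup w i ⟩
    adj G w (f i)             ∎
    where open ≡-Reasoning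

  no-copy : ∀ s → ¬ ContainsInduced 5 (shapeAdj s) G
  no-copy path  = noP5
  no-copy wheel = noW4

  -- Vertex i of the configuration is f i, and vertex 7 + p is lookup xs p.
  configuration-free : ∀ {r} (xs : Vec (Vertex G) r) → Unique xs → (∀ p → Outside (lookup xs p)) →
                       ∀ {ns} → Vec.map attachment xs ≡ ns →
                       ∀ {E} → (∀ p q → adj G (lookup xs p) (lookup xs q) ≡ E p q) →
                       ∀ cs → ¬ HasCopyAmong cs (extension ns E)
  configuration-free {r} xs unique outside refl {E} xs-adj cs found with satisfied found
  ... | s at _ , copy = no-copy s (induced-trans G (embedding-adj , embedding-injective) copy)
    where
    embed : Fin 7 ⊎ Fin r → Vertex G
    embed = [ f , lookup xs ]

    attachment-of-xs : ∀ p i → lookup (lookup (Vec.map attachment xs) p) i ≡ adj G (lookup xs p) (f i)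
    attachment-of-xs p i =
      trans (cong (λ s → lookup s i) (lookup-map p attachment xs)) (attachment-lookup (lookup xs p) i)

    embed-adj : ∀ s t → adj G (embed s) (embed t) ≡ extend (Vec.map attachment xs) E s t
    embed-adj (inj₁ i) (inj₁ j) = f-adj i j
    embed-adj (inj₁ i) (inj₂ q) = trans (sym G (f i) (lookup xs q)) (≡.sym (attachment-of-xs q i))
    embed-adj (inj₂ p) (inj₁ j) = ≡.sym (attachment-of-xs p j)
    embed-adj (inj₂ p) (inj₂ q) = xs-adj p q

    embed-injective : ∀ s t → embed s ≡ embed t → s ≡ t
    embed-injective (inj₁ i) (inj₁ j) eq = cong inj₁ (f-injective eq)
    embed-injective (inj₁ i) (inj₂ q) eq = ⊥-elim (outside q i eq)
    embed-injective (inj₂ p) (inj₁ j) eq = ⊥-elim (outside p j (≡.sym eq))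
    embed-injective (inj₂ p) (inj₂ q) eq = cong inj₂ (lookup-injective unique p q eq)

    embedding-adj : ∀ u v → adj G (embed (splitAt 7 u)) (embed (splitAt 7 v)) ≡
                            extension (Vec.map attachment xs) E u v
    embedding-adj u v = embed-adj (splitAt 7 u) (splitAt 7 v)

    embedding-injective : Injective _≡_ _≡_ (embed ∘ splitAt 7)
    embedding-injective {u} {v} eq = begin
      u                         ≡⟨ join-splitAt 7 r u ⟨
      join 7 r (splitAt 7 u)    ≡⟨ cong (join 7 r) (embed-injective (splitAt 7 u) (splitAt 7 v) eq) ⟩
      join 7 r (splitAt 7 v)    ≡⟨ join-splitAt 7 r v ⟩
      v                         ∎
      where open ≡-Reasoning

  classified : ∀ {v} → Outside v → ∃ λ a → InClass a v
  classified {v} v-out with attachment-listed (attachment v)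
  ... | inj₁ (a , listed) = a , in-class v-out (≡.sym listed)
  ... | inj₂ forbidden    = ⊥-elim
    (configuration-free (v ∷ []) ([] ∷ []) (λ { zero → v-out }) refl (λ { zero zero → irrefl G v })
                        oneVertexCopies forbidden)

  pair-allowed : ∀ {a b x y} → InClass a x → InClass b y → x ≢ y → ¬ ForbiddenPair a b (adj G x y)
  pair-allowed {x = x} {y} (in-class x-out x-att) (in-class y-out y-att) x≢y =
    configuration-free xs ((x≢y ∷ []) ∷ [] ∷ []) outside
                       (cong₂ _∷_ x-att (cong (_∷ []) y-att)) adjacency twoVertexCopies
    where
    xs : Vec (Vertex G) 2
    xs = x ∷ y ∷ []

    outside : ∀ p → Outside (lookup xs p)
    outside zero       = x-out
    outside (suc zero) = y-out

    adjacency : ∀ p q → adj G (lookup xs p) (lookup xs q) ≡ edge (adj G x y) p q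
    adjacency zero       zero       = irrefl G x
    adjacency zero       (suc zero) = refl
    adjacency (suc zero) zero       = sym G y x
    adjacency (suc zero) (suc zero) = irrefl G y

  class-transitive : ∀ {a x y z} → ForbiddenPath a → InClass a x → InClass a y → InClass a z →
                     adj G x y ≡ true → adj G y z ≡ true → x ≢ z → adj G x z ≡ true
  class-transitive {x = x} {y} {z} forbidden (in-class x-out x-att) (in-class y-out y-att)
                   (in-class z-out z-att) xy yz x≢z with adj G x z in xz
  ... | true  = refl
  ... | false = ⊥-elim
    (configuration-free xs unique outside (cong₂ _∷_ x-att (cong₂ _∷_ y-att (cong (_∷ []) z-att)))
                        adjacency pathCopies forbidden)
    where
    xs : Vec (Vertex G) 3
    xs = x ∷ y ∷ z ∷ []

    unique : Unique xs
    unique = (adj⇒≢ G xy ∷ x≢z ∷ []) ∷ (adj⇒≢ G yz ∷ []) ∷ [] ∷ []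

    outside : ∀ p → Outside (lookup xs p)
    outside zero             = x-out
    outside (suc zero)       = y-out
    outside (suc (suc zero)) = z-out

    adjacency : ∀ p q → adj G (lookup xs p) (lookup xs q) ≡ path₃ p q
    adjacency zero             zero             = irrefl G x
    adjacency zero             (suc zero)       = xy
    adjacency zero             (suc (suc zero)) = xz
    adjacency (suc zero)       zero             = trans (sym G y x) xy
    adjacency (suc zero)       (suc zero)       = irrefl G y
    adjacency (suc zero)       (suc (suc zero)) = yz
    adjacency (suc (suc zero)) zero             = trans (sym G z x) xz
    adjacency (suc (suc zero)) (suc zero)       = trans (sym G z y) yz
    adjacency (suc (suc zero)) (suc (suc zero)) = irrefl G z

  class-determined : ∀ {a x v w} → Clustered a → InClass a x → InClass a v → Outside w →
                     adj G x w ≡ true → adj G v w ≡ false → InClass a w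
  class-determined {a} {v = v} {w} (_ , determined) x-in v-in w-out xw vw with v ≟ w
  ... | yes refl = v-in
  ... | no  v≢w with classified w-out
  ... | b , w-in with b ≟ a
  ... | yes refl = w-in
  ... | no  b≢a with determined b b≢a
  ... | inj₁ adjacent-forbidden = ⊥-elim
    (pair-allowed x-in w-in (adj⇒≢ G xw) (subst (ForbiddenPair a b) (≡.sym xw) adjacent-forbidden))
  ... | inj₂ nonadjacent-forbidden = ⊥-elim
    (pair-allowed v-in w-in v≢w (subst (ForbiddenPair a b) (≡.sym vw) nonadjacent-forbidden))

  module Critical {k : ℕ} (critical : VertexCritical k G) where

    colouring : Colourable G k
    colouring = proj₁ (proj₁ critical)

    not-colourable : ¬ Colourable G (pred k)
    not-colourable = critical-not-colourable critical (f zero)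

    colouring-except : ∀ {x} → Outside x → Σ (Vertex G → Fin (pred k)) (ProperExcept G x)
    colouring-except x-out = critical-colouring-except critical (x-out zero)

    empty-class-separated : ∀ v w → InClass empty v → ¬ InClass empty w → adj G v w ≡ false
    empty-class-separated v w v-in w-notin with on-C7bar-or-outside w
    ... | inj₁ (i , refl) = begin
      adj G v (f i)            ≡⟨ attachment-lookup v i ⟨
      lookup (attachment v) i  ≡⟨ cong (λ s → lookup s i) (has-attachment v-in) ⟩
      lookup ⟦ [] ⟧ i          ≡⟨ lookup-replicate i false ⟩
      false                    ∎
      where open ≡-Reasoning
    ... | inj₂ w-out with classified w-out | adj G v w in vw
    ... | _ , _    | false = refl
    ... | b , w-in | true  = ⊥-elim
      (pair-allowed v-in w-in v≢w (subst (ForbiddenPair empty b) (≡.sym vw) (empty-isolated b b≢empty)))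
      where
      v≢w : v ≢ w
      v≢w refl = w-notin v-in

      b≢empty : b ≢ empty
      b≢empty refl = w-notin w-in

    empty-class-empty : ∀ {v} → ¬ InClass empty v
    empty-class-empty v-in = critical⇒connected critical (inClass? empty) empty-class-separated
                                                v-in (λ f0-in → is-outside f0-in zero refl)

    module _ {a : Attachment} (clustered : Clustered a) where

      Near : Vertex G → Vertex G → Set
      Near y v = InClass a v × (v ≡ y ⊎ adj G v y ≡ true)

      near? : ∀ y v → Dec (Near y v)
      near? y v = inClass? a v ×-dec ((v ≟ y) ⊎-dec (adj G v y Bool.≟ true))

      near-clique : ∀ {y v w} → InClass a y → Near y v → Near y w → v ≢ w → adj G v w ≡ true
      near-clique y-in (_ , inj₁ refl) (_ , inj₁ refl) v≢w = ⊥-elim (v≢w refl)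
      near-clique y-in (_ , inj₁ refl) (_ , inj₂ wy) v≢w = trans (sym G _ _) wy
      near-clique y-in (_ , inj₂ vy) (_ , inj₁ refl) v≢w = vy
      near-clique {y} y-in (v-in , inj₂ vy) (w-in , inj₂ wy) v≢w =
        class-transitive (proj₁ clustered) v-in y-in w-in vy (trans (sym G y _) wy) v≢w

      module Transfer {x y} (x-in : InClass a x) (y-in : InClass a y) (x≢y : x ≢ y)
                      (x≁y : adj G x y ≡ false) where

        colour : Vertex G → Fin (pred k)
        colour = proj₁ (colouring-except (is-outside x-in))

        proper : ProperExcept G x colour
        proper = proj₂ (colouring-except (is-outside x-in))

        chosen : ∀ v → ∃ λ w → adj G x w ≡ true × colour w ≡ colour v
        chosen v = colour-at-neighbour G not-colourable colour proper (colour v)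

        φ : Vertex G → Vertex G
        φ v = proj₁ (chosen v)

        φ-adj : ∀ v → adj G x (φ v) ≡ true
        φ-adj v = proj₁ (proj₂ (chosen v))

        φ-colour : ∀ v → colour (φ v) ≡ colour v
        φ-colour v = proj₂ (proj₂ (chosen v))

        near⇒≢x : ∀ {v} → Near y v → v ≢ x
        near⇒≢x (_ , inj₁ refl) refl = x≢y refl
        near⇒≢x (_ , inj₂ vy)   refl = case trans (≡.sym vy) x≁y of λ ()

        φ-near : ∀ {v} → Near y v → Near x (φ v) × φ v ≢ x
        φ-near {v} v-near@(v-in , _) =
          (class-determined clustered x-in v-in w-out (φ-adj v) v≁w , inj₂ (trans (sym G w x) (φ-adj v)))
          , w≢x
          where
          w : Vertex G
          w = φ v

          w≢x : w ≢ x
          w≢x = adj⇒≢ G (φ-adj v) ∘ ≡.sym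

          v≁w : adj G v w ≡ false
          v≁w with adj G v w in vw
          ... | false = refl
          ... | true  = ⊥-elim (proper v w (near⇒≢x v-near) w≢x vw (≡.sym (φ-colour v)))

          w-out : Outside w
          w-out i fi≡w = case trans (≡.sym v-to-fi) v≁w of λ ()
            where
            v~x : attachment v ≡ attachment x
            v~x = trans (has-attachment v-in) (≡.sym (has-attachment x-in))

            v-to-fi : adj G v w ≡ true
            v-to-fi = begin
              adj G v w      ≡⟨ cong (adj G v) fi≡w ⟨
              adj G v (f i)  ≡⟨ same-attachment v~x i ⟩
              adj G x (f i)  ≡⟨ cong (adj G x) fi≡w ⟩
              adj G x w      ≡⟨ φ-adj v ⟩
              true           ∎
              where open ≡-Reasoning

        φ-injective : ∀ {v w} → Near y v → Near y w → φ v ≡ φ w → v ≡ w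
        φ-injective {v} {w} v-near w-near φv≡φw =
          decidable-stable (v ≟ w) λ v≢w →
            proper v w (near⇒≢x v-near) (near⇒≢x w-near) (near-clique y-in v-near w-near v≢w) same-colour
          where
          same-colour : colour v ≡ colour w
          same-colour = begin
            colour v      ≡⟨ φ-colour v ⟨
            colour (φ v)  ≡⟨ cong colour φv≡φw ⟩
            colour (φ w)  ≡⟨ φ-colour w ⟩
            colour w      ∎
            where open ≡-Reasoning

      class-complete : ∀ {x y} → InClass a x → InClass a y → x ≢ y → adj G x y ≡ true
      class-complete {x} {y} x-in y-in x≢y with adj G x y in xy
      ... | true  = refl
      ... | false = ⊥-elim (no-injection-into-proper-subset (near? x) ψ (proj₁ ∘ ψ-near) ψ-injective
                                                           (x-in , inj₁ refl) (proj₂ ∘ ψ-near))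
        where
        module X = Transfer x-in y-in x≢y xy
        module Y = Transfer y-in x-in (x≢y ∘ ≡.sym) (trans (sym G y x) xy)

        ψ : Vertex G → Vertex G
        ψ = X.φ ∘ Y.φ

        ψ-near : ∀ {v} → Near x v → Near x (ψ v) × ψ v ≢ x
        ψ-near = X.φ-near ∘ proj₁ ∘ Y.φ-near

        ψ-injective : ∀ {v w} → Near x v → Near x w → ψ v ≡ ψ w → v ≡ w
        ψ-injective v-near w-near =
          Y.φ-injective v-near w-near ∘ X.φ-injective (proj₁ (Y.φ-near v-near)) (proj₁ (Y.φ-near w-near))

    same-class-adjacent : ∀ {a v w} → InClass a v → InClass a w → v ≢ w → adj G v w ≡ true
    same-class-adjacent {a} {v} {w} v-in w-in v≢w with a ≟ empty
    ... | yes refl = ⊥-elim (empty-class-empty v-in)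
    ... | no  a≢empty with complete-or-clustered a a≢empty
    ... | inj₂ clustered = class-complete clustered v-in w-in v≢w
    ... | inj₁ nonadjacent-forbidden with adj G v w in vw
    ...   | true  = refl
    ...   | false = ⊥-elim (pair-allowed v-in w-in v≢w
                              (subst (ForbiddenPair a a) (≡.sym vw) nonadjacent-forbidden))

    label : Vertex G → Fin 7 ⊎ Attachment
    label v with on-C7bar-or-outside v
    ... | inj₁ (i , _) = inj₁ i
    ... | inj₂ v-out   = inj₂ (proj₁ (classified v-out))

    same-label-adjacent : ∀ {v w} → v ≢ w → label v ≡ label w → adj G v w ≡ true
    same-label-adjacent {v} {w} v≢w with on-C7bar-or-outside v | on-C7bar-or-outside w
    ... | inj₁ (i , refl) | inj₁ (j , refl) = λ eq → ⊥-elim (v≢w (cong f (inj₁-injective eq)))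
    ... | inj₁ _          | inj₂ _          = λ ()
    ... | inj₂ _          | inj₁ _          = λ ()
    ... | inj₂ v-out      | inj₂ w-out      = λ eq →
      same-class-adjacent (proj₂ (classified v-out))
        (subst (λ b → InClass b w) (≡.sym (inj₂-injective eq)) (proj₂ (classified w-out))) v≢w

    size≤ : size G ≤ (7 + 29) * k
    size≤ = size≤labels*colours G (proj₁ colouring) (proj₂ colouring) (join 7 29 ∘ label)
              λ v≢w eq → same-label-adjacent v≢w (join-injective eq)
      where
      join-injective : ∀ {s t} → join 7 29 s ≡ join 7 29 t → s ≡ t
      join-injective {s} {t} eq = begin
        s                         ≡⟨ splitAt-join 7 29 s ⟨
        splitAt 7 (join 7 29 s)   ≡⟨ cong (splitAt 7) eq ⟩
        splitAt 7 (join 7 29 t)   ≡⟨ splitAt-join 7 29 t ⟩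
        t                         ∎
        where open ≡-Reasoning

lemma3p2 : ∀ (k : ℕ) → 1 ≤ k → ∃ λ (N : ℕ) → ∀ (G : Graph) →
    VertexCritical k G → ¬ ContainsInduced 5 P5 G → ¬ ContainsInduced 5 W4 G →
    ContainsInduced 7 C7bar G → size G ≤ N
lemma3p2 k _ = (7 + 29) * k , λ G critical noP5 noW4 (f , f-injective , f-adj) →
  AroundC7bar.Critical.size≤ G noP5 noW4 f f-injective f-adj critical
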